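{- Every branch that is refutable in the tableau calculus $\mathcal T$ is unsatisfiable.
   Context: Types are generated from countably many base types by: if $\sigma,\tau$ are types then $\sigma\tau$ is a type (functions from $\sigma$ to $\tau$). One base type $o$ (truth values) is fixed; the other base types are called sorts ($\alpha$). There are countably many names, each with a unique type, infinitely many of every type. Terms: names; $st$ of type $\mu$ if $s$ has type $\tau\mu$ and $t$ type $\tau$; $\lambda x.t$ of type $\sigma\tau$ if $x$ is a name of type $\sigma$ and $t$ has type $\tau$. The logical constants are fixed names $\neg$ of type $oo$ and $=_\sigma$ of type $\sigma\sigma o$ for each type $\sigma$; all other names are variables. A formula is a term of type $o$; $s=_\sigma t$ stands for $(=_\sigma)st$ and $s\neq_\sigma t$ for $\neg(s=_\sigma t)$. A frame is a function $\mathcal D$ mapping every type to a nonempty set with $\mathcal D(\sigma\tau)\subseteq(\mathcal D\sigma\to\mathcal D\tau)$. An assignment into $\mathcal D$ is a function $\mathcal I$ extending $\mathcal D$ and mapping every name of type $\sigma$ to an element of $\mathcal D\sigma$; $\mathcal I^x_a$ agrees with $\mathcal I$ except that it maps $x$ to $a$. The partial evaluation $\hat{\mathcal I}$: $\hat{\mathcal I}x=\mathcal Ix$; $\hat{\mathcal I}(st)=(\hat{\mathcal I}s)(\hat{\mathcal I}t)$ when both are defined; $\hat{\mathcal I}(\lambda x.s)=f$ if $\lambda x.s$ has type $\sigma\tau$, $f\in\mathcal D(\sigma\tau)$ and $\widehat{\mathcal I^x_a}s=fa$ for all $a\in\mathcal D\sigma$ (undefined otherwise). An interpretation is an assignment whose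 evaluation is defined on all terms. An assignment is logical if $\mathcal Io=\{0,1\}$, $\mathcal I(\neg)$ is negation and $\mathcal I(=_\sigma)$ is the identity predicate on $\mathcal I\sigma$. A model of a set $A$ of formulas is a logical interpretation $\mathcal I$ with $\hat{\mathcal I}s=1$ for all $s\in A$; $A$ is satisfiable if it has a model. A fixed normalization operator $s\mapsto[s]$ is a type-preserving total function on terms with (N1) $[[s]]=[s]$; (N2) $[[s]t]=[st]$; (N3) $[xs_1\dots s_n]=x[s_1]\dots[s_n]$ for a name $x$, $n\ge 0$, $xs_1\dots s_n$ of base type; (N4) $\hat{\mathcal I}[s]=\hat{\mathcal I}s$ for every interpretation $\mathcal I$. A term $s$ is normal if $[s]=s$. A branch is a set of normal formulas. The tableau calculus $\mathcal T$ works on finite branches. A rule instance $A/A_1,\dots,A_n$ ($n\ge0$) consists of a finite branch $A$ containing the premises of one of the following rules and the branches $A_i=A\cup C_i$, where $C_1\mid\dots\mid C_n$ are the rule's alternatives: (DN) from $\neg\neg s$: $\{s\}$; (BQ) from $s=_o t$: $\{s,t\}\mid\{\neg s,\neg t\}$; (BE) from $s\neq_o t$: $\{s,\neg t\}\mid\{\neg s,t\}$; (FQ) from $s=_{\sigma\tau}t$: $\{[su]=[tu]\}$ for any normal $u$ of type $\sigma$; (FE) from $s\neq_{\sigma\tau}t$: $\{[sx]\neq[tx]\}$ where $x$ is a variable of type $\sigma$ not occurring free in $A$; (Mat) from $xs_1\dots s_n$ and $\neg xt_1\dots t_n$ ($x$ a variable, $n\ge0$): $\{s_1\neq t_1\}\mid\dots\mid\{s_n\neq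 t_n\}$; (Dec) from $xs_1\dots s_n\neq_\alpha xt_1\dots t_n$ ($x$ a variable, $\alpha$ a sort, $n\ge0$): $\{s_1\neq t_1\}\mid\dots\mid\{s_n\neq t_n\}$; (Con) from $s=_\alpha t$ and $u\neq_\alpha v$: $\{s\neq u,t\neq u\}\mid\{s\neq v,t\neq v\}$. A branch is closed if it contains $x$ and $\neg x$ for a variable $x$ of type $o$, or $x\neq_\alpha x$ for a variable $x$ of a sort $\alpha$ (exactly the cases where Mat or Dec applies with $n=0$). Restrictions: (1) apart from the instances of Mat and Dec with $n=0$, rule instances are admitted only if $A$ is not closed; (2) FE may be applied to $s\neq t\in A$ only if there is no variable $x$ with $([sx]\neq[tx])\in A$. The set of refutable branches is the least set such that if $A/A_1,\dots,A_n$ is an admitted rule instance and $A_1,\dots,A_n$ are refutable, then $A$ is refutable. -}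

module Defs where

open import Data.Nat using (ℕ)
import Data.Nat.Properties as ℕP
open import Data.Bool using (Bool; true; not)
open import Data.Unit using (⊤)
open import Data.Empty using (⊥)
open import Data.Product using (Σ; _×_; _,_)
open import Data.Sum using (_⊎_)
open import Data.List using (List; []; _∷_; _++_)
open import Data.List.Membership.Propositional using (_∈_; _∉_)
open import Data.List.Relation.Unary.Any using (Any)
open import Data.List.Relation.Unary.All using (All)
open import Function.Bundles using (_⤖_; Bijection; _⇔_)
open import Relation.Nullary using (¬_; Dec; yes; no)
open import Relation.Binary.PropositionalEquality using (_≡_; _≢_; refl; cong)

data Ty : Set where
  o   : Ty
  srt : ℕ → Ty
  _⇒_ : Ty → Ty → Ty

infixr 5 _⇒_

Base : Ty → Set
Base o       = ⊤
Base (srt _) = ⊤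
Base (_ ⇒ _) = ⊥

-- Names: the logical constants ¬ (neg) and =_σ (eqn σ), and
-- variables var σ n (infinitely many of every type σ).

data Name : Set where
  neg : Name
  eqn : Ty → Name
  var : Ty → ℕ → Name

type : Name → Ty
type neg       = o ⇒ o
type (eqn σ)   = σ ⇒ σ ⇒ o
type (var σ _) = σ

_≟T_ : (σ τ : Ty) → Dec (σ ≡ τ)
o ≟T o = yes refl
o ≟T srt _ = no λ ()
o ≟T (_ ⇒ _) = no λ ()
srt _ ≟T o = no λ ()
srt k ≟T srt l with k ℕP.≟ l
... | yes refl = yes refl
... | no k≢l = no λ { refl → k≢l refl }
srt _ ≟T (_ ⇒ _) = no λ ()
(_ ⇒ _) ≟T o = no λ ()
(_ ⇒ _) ≟T srt _ = no λ ()
(σ ⇒ τ) ≟T (σ' ⇒ τ') with σ ≟T σ' | τ ≟T τ'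
... | yes refl | yes refl = yes refl
... | no ne | _ = no λ { refl → ne refl }
... | yes _ | no ne = no λ { refl → ne refl }

_≟N_ : (x y : Name) → Dec (x ≡ y)
neg ≟N neg = yes refl
neg ≟N eqn _ = no λ ()
neg ≟N var _ _ = no λ ()
eqn _ ≟N neg = no λ ()
eqn σ ≟N eqn τ with σ ≟T τ
... | yes refl = yes refl
... | no ne = no λ { refl → ne refl }
eqn _ ≟N var _ _ = no λ ()
var _ _ ≟N neg = no λ ()
var _ _ ≟N eqn _ = no λ ()
var σ n ≟N var τ m with σ ≟T τ | n ℕP.≟ m
... | yes refl | yes refl = yes refl
... | no ne | _ = no λ { refl → ne refl }
... | yes _ | no ne = no λ { refl → ne refl }

data Tm : Ty → Set where
  nm  : (x : Name) → Tm (type x)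
  app : ∀ {σ τ} → Tm (σ ⇒ τ) → Tm σ → Tm τ
  lam : ∀ {τ} (x : Name) → Tm τ → Tm (type x ⇒ τ)

Formula : Set
Formula = Tm o

_≐_ : ∀ {σ} → Tm σ → Tm σ → Formula
_≐_ {σ} s t = app (app (nm (eqn σ)) s) t

~_ : Formula → Formula
~ s = app (nm neg) s

_≠_ : ∀ {σ} → Tm σ → Tm σ → Formula
s ≠ t = ~ (s ≐ t)

infix 6 _≐_ _≠_

data Args : Ty → Ty → Set where
  ε   : ∀ {ρ} → Args ρ ρ
  _◂_ : ∀ {σ τ ρ} → Tm σ → Args τ ρ → Args (σ ⇒ τ) ρ

infixr 5 _◂_

apps : ∀ {σ ρ} → Tm σ → Args σ ρ → Tm ρ
apps h ε        = h
apps h (s ◂ ss) = apps (app h s) ss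

mapArgs : (∀ {σ} → Tm σ → Tm σ) → ∀ {σ ρ} → Args σ ρ → Args σ ρ
mapArgs f ε        = ε
mapArgs f (s ◂ ss) = f s ◂ mapArgs f ss

IsEmpty : ∀ {σ ρ} → Args σ ρ → Set
IsEmpty ε       = ⊤
IsEmpty (_ ◂ _) = ⊥

diffs : ∀ {σ ρ} → Base ρ → Args σ ρ → Args σ ρ → List (List Formula)
diffs b ε ε               = []
diffs () ε (_ ◂ _)
diffs () (_ ◂ _) ε
diffs b (s ◂ ss) (t ◂ ts) = ((s ≠ t) ∷ []) ∷ diffs b ss ts

data FreeIn (x : Name) : ∀ {σ} → Tm σ → Set where
  free-nm   : FreeIn x (nm x)
  free-app₁ : ∀ {σ τ} {s : Tm (σ ⇒ τ)} {t : Tm σ} → FreeIn x s → FreeIn x (app s t)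
  free-app₂ : ∀ {σ τ} {s : Tm (σ ⇒ τ)} {t : Tm σ} → FreeIn x t → FreeIn x (app s t)
  free-lam  : ∀ {τ} {y : Name} {s : Tm τ} → x ≢ y → FreeIn x s → FreeIn x (lam y s)

FreeInBranch : Name → List Formula → Set
FreeInBranch x A = Any (FreeIn x) A

-- A frame: a nonempty set D σ for each type, with D (σ ⇒ τ) a subset of
-- the function space D σ → D τ, represented by an injective
-- (i.e. extensional) application map.
record Frame : Set₁ where
  field
    D        : Ty → Set
    nonempty : ∀ σ → D σ
    ap       : ∀ {σ τ} → D (σ ⇒ τ) → D σ → D τ
    ext      : ∀ {σ τ} (f g : D (σ ⇒ τ)) → (∀ a → ap f a ≡ ap g a) → f ≡ g

open Frame public

Asg : Frame → Set
Asg F = (x : Name) → D F (type x)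

upd : (F : Frame) → Asg F → (x : Name) → D F (type x) → Asg F
upd F I x a y with x ≟N y
... | yes refl = a
... | no _     = I y

-- partial evaluation as a relation:  Eval I s a  means  Î s is defined and = a
data Eval (F : Frame) : Asg F → ∀ {σ} → Tm σ → D F σ → Set where
  ev-nm  : ∀ {I} (x : Name) → Eval F I (nm x) (I x)
  ev-app : ∀ {I σ τ} {s : Tm (σ ⇒ τ)} {t : Tm σ} {f a}
           → Eval F I s f → Eval F I t a → Eval F I (app s t) (ap F f a)
  ev-lam : ∀ {I τ} {x : Name} {s : Tm τ} {f : D F (type x ⇒ τ)}
           → (∀ a → Eval F (upd F I x a) s (ap F f a)) → Eval F I (lam x s) f

Interpretation : (F : Frame) → Asg F → Set
Interpretation F I = ∀ {σ} (t : Tm σ) → Σ (D F σ) (λ a → Eval F I t a)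

-- logical assignment: D o = {0,1} (via a bijection with Bool),
-- ¬ is negation, =_σ is the identity predicate on D σ
record Logical (F : Frame) (I : Asg F) : Set where
  field
    truth : D F o ⤖ Bool
  val : D F o → Bool
  val = Bijection.to truth
  field
    neg-is-not : ∀ a → val (ap F (I neg) a) ≡ not (val a)
    eq-is-id   : ∀ σ (a b : D F σ) → (val (ap F (ap F (I (eqn σ)) a) b) ≡ true) ⇔ (a ≡ b)

record Model (A : List Formula) (F : Frame) (I : Asg F) : Set where
  field
    logical : Logical F I
    interp  : Interpretation F I
    true-in : ∀ s → s ∈ A → Σ (D F o) (λ a → Eval F I s a × Logical.val logical a ≡ true)

Satisfiable : List Formula → Set₁
Satisfiable A = Σ Frame λ F → Σ (Asg F) λ I → Model A F I

NormOp : Set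
NormOp = ∀ {σ} → Tm σ → Tm σ

record IsNormalizer (norm : NormOp) : Set₁ where
  field
    N1 : ∀ {σ} (s : Tm σ) → norm (norm s) ≡ norm s
    N2 : ∀ {σ τ} (s : Tm (σ ⇒ τ)) (t : Tm σ) → norm (app (norm s) t) ≡ norm (app s t)
    N3 : ∀ (x : Name) {ρ} (ss : Args (type x) ρ) → Base ρ
         → norm (apps (nm x) ss) ≡ apps (nm x) (mapArgs norm ss)
    N4 : ∀ (F : Frame) (I : Asg F) → Interpretation F I
         → ∀ {σ} (s : Tm σ) (a : D F σ) → Eval F I (norm s) a ⇔ Eval F I s a

Normal : NormOp → ∀ {σ} → Tm σ → Set
Normal norm s = norm s ≡ s

module Tableau (norm : NormOp) where

  Closed : List Formula → Set
  Closed A = Σ ℕ (λ n → (nm (var o n) ∈ A) × ((~ nm (var o n)) ∈ A))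
           ⊎ Σ ℕ (λ k → Σ ℕ λ n → (nm (var (srt k) n) ≠ nm (var (srt k) n)) ∈ A)

  -- rule instances  A / A ∪ C₁, …, A ∪ Cₙ  given by the list of alternatives C₁ … Cₙ
  data Step (A : List Formula) : List (List Formula) → Set where
    DN  : ∀ {s} → (~ (~ s)) ∈ A → Step A ((s ∷ []) ∷ [])
    BQ  : ∀ {s t : Formula} → (s ≐ t) ∈ A
          → Step A ((s ∷ t ∷ []) ∷ ((~ s) ∷ (~ t) ∷ []) ∷ [])
    BE  : ∀ {s t : Formula} → (s ≠ t) ∈ A
          → Step A ((s ∷ (~ t) ∷ []) ∷ ((~ s) ∷ t ∷ []) ∷ [])
    FQ  : ∀ {σ τ} {s t : Tm (σ ⇒ τ)} → (s ≐ t) ∈ A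
          → (u : Tm σ) → Normal norm u
          → Step A ((norm (app s u) ≐ norm (app t u) ∷ []) ∷ [])
    FE  : ∀ {σ τ} {s t : Tm (σ ⇒ τ)} → (s ≠ t) ∈ A
          → (n : ℕ) → ¬ FreeInBranch (var σ n) A
          → (∀ m → (norm (app s (nm (var σ m))) ≠ norm (app t (nm (var σ m)))) ∉ A)
          → Step A ((norm (app s (nm (var σ n))) ≠ norm (app t (nm (var σ n))) ∷ []) ∷ [])
    MatR : ∀ {σ} (n : ℕ) (ss ts : Args σ o)
          → apps (nm (var σ n)) ss ∈ A → (~ apps (nm (var σ n)) ts) ∈ A
          → Step A (diffs _ ss ts)
    DecR : ∀ {σ} (k n : ℕ) (ss ts : Args σ (srt k))
          → (apps (nm (var σ n)) ss ≠ apps (nm (var σ n)) ts) ∈ A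
          → Step A (diffs _ ss ts)
    Con : ∀ {k} {s t u v : Tm (srt k)} → (s ≐ t) ∈ A → (u ≠ v) ∈ A
          → Step A (((s ≠ u) ∷ (t ≠ u) ∷ []) ∷ ((s ≠ v) ∷ (t ≠ v) ∷ []) ∷ [])

  Nullary : ∀ {A alts} → Step A alts → Set
  Nullary (MatR _ ss _ _ _) = IsEmpty ss
  Nullary (DecR _ _ ss _ _) = IsEmpty ss
  Nullary _                = ⊥

  Admitted : ∀ {A alts} → Step A alts → Set
  Admitted {A} r = Nullary r ⊎ ¬ Closed A

  data Refutable : List Formula → Set where
    refute : ∀ {A alts} (r : Step A alts) → Admitted r
             → (∀ C → C ∈ alts → Refutable (C ++ A))
             → Refutable A

-- Every rule is sound: a model of the premise A is a model of one of the alternatives A ∪ Cᵢ,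
-- except for FE, where the model has to be changed at the fresh variable x.  Constructively
-- we show only that not all alternatives are unsatisfiable, which suffices for induction on
-- refutations.  A logical interpretation decides equality in every domain (through the value
-- of =_σ), so each rule can case-split on the values of the terms involved.  For FE: as x is
-- fresh for A, every update I^x_a is still a model of A; if none of them satisfied
-- [sx] ≠ [tx], the denotations of s and t would agree pointwise, hence be equal by
-- extensionality of the frame, contradicting s ≠ t.
module Submission where

open import Defs
open import Data.Bool using (Bool; true; false; not)
import Data.Bool as Bool
open import Data.Bool.Properties using (not-injective; not-¬; ¬-not)
open import Data.Empty using (⊥-elim)
open import Data.List using (List; []; _∷_; _++_)
open import Data.List.Membership.Propositional using (_∈_; lose)
open import Data.List.Membership.Propositional.Properties using (∈-++⁻)
open import Data.List.Relation.Unary.All using (All; []; _∷_)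
import Data.List.Relation.Unary.All as All
open import Data.List.Relation.Unary.Any using (here; there)
open import Data.Product using (_,_; proj₁; proj₂)
open import Data.Sum using ([_,_]′)
open import Function using (_∘_; _∘′_)
open import Function.Bundles using (Bijection; Equivalence; _⇔_)
open import Relation.Binary.PropositionalEquality
  using (_≡_; _≢_; refl; sym; trans; cong; cong₂; subst; module ≡-Reasoning)
open import Relation.Nullary using (¬_; Dec; yes; no)
import Relation.Nullary.Decidable as Dec

module Evaluation (F : Frame) where

  upd-same : (I : Asg F) (x : Name) (a : D F (type x)) → upd F I x a x ≡ a
  upd-same I x a with x ≟N x
  ... | yes refl = refl
  ... | no x≢x   = ⊥-elim (x≢x refl)

  upd-other : (I : Asg F) (x : Name) (a : D F (type x)) (z : Name)
            → x ≢ z → upd F I x a z ≡ I z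
  upd-other I x a z x≢z with x ≟N z
  ... | yes refl = ⊥-elim (x≢z refl)
  ... | no _     = refl

  upd-cong : (I J : Asg F) (x : Name) (a : D F (type x)) (z : Name)
           → (x ≢ z → I z ≡ J z) → upd F I x a z ≡ upd F J x a z
  upd-cong I J x a z I≡J with x ≟N z
  ... | yes refl = refl
  ... | no x≢z   = I≡J x≢z

  Eval-functional : ∀ {I σ} {t : Tm σ} {a b} → Eval F I t a → Eval F I t b → a ≡ b
  Eval-functional (ev-nm x)      (ev-nm .x)     = refl
  Eval-functional (ev-app e₁ e₂) (ev-app e₃ e₄) =
    cong₂ (ap F) (Eval-functional e₁ e₃) (Eval-functional e₂ e₄)
  Eval-functional (ev-lam k₁)    (ev-lam k₂)    =
    ext F _ _ λ a → Eval-functional (k₁ a) (k₂ a)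

  Eval-coincidence : ∀ {I J σ} {t : Tm σ} {a}
                   → (∀ z → FreeIn z t → I z ≡ J z) → Eval F I t a → Eval F J t a
  Eval-coincidence {J = J} I≡J (ev-nm x) = subst (Eval F J (nm x)) (sym (I≡J x free-nm)) (ev-nm x)
  Eval-coincidence I≡J (ev-app e₁ e₂) =
    ev-app (Eval-coincidence (λ z → I≡J z ∘′ free-app₁) e₁)
           (Eval-coincidence (λ z → I≡J z ∘′ free-app₂) e₂)
  Eval-coincidence {I} {J} I≡J (ev-lam {x = y} k) = ev-lam λ a →
    Eval-coincidence (λ z z∈ → upd-cong I J y a z λ y≢z → I≡J z (free-lam (y≢z ∘ sym) z∈)) (k a)

  Eval-upd-fresh : ∀ {I A x a σ} {t : Tm σ} {v} → ¬ FreeInBranch x A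
                 → (∀ z → FreeIn z t → FreeInBranch z A) → Eval F I t v → Eval F (upd F I x a) t v
  Eval-upd-fresh {I} {x = x} {a} fresh t⊆A = Eval-coincidence λ z z∈t →
    sym (upd-other I x a z λ { refl → fresh (t⊆A z z∈t) })

  -- The value of λx.t at a is a value of t under I^x_a.
  Interpretation-upd : ∀ {I} → Interpretation F I → ∀ x a → Interpretation F (upd F I x a)
  Interpretation-upd interp x a t with interp (lam x t)
  ... | f , ev-lam k = ap F f a , k a

  Logical-upd : ∀ {I} → Logical F I → ∀ σ n a → Logical F (upd F I (var σ n) a)
  Logical-upd L _ _ _ = record
    { truth = truth ; neg-is-not = neg-is-not ; eq-is-id = eq-is-id }
    where open Logical L

module Denotation {F : Frame} {I : Asg F} (L : Logical F I) (interp : Interpretation F I) where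
  open Evaluation F
  open Logical L

  ⟦_⟧ : ∀ {σ} → Tm σ → D F σ
  ⟦ t ⟧ = proj₁ (interp t)

  ⟦⟧-unique : ∀ {σ} {t : Tm σ} {a} → Eval F I t a → ⟦ t ⟧ ≡ a
  ⟦⟧-unique = Eval-functional (proj₂ (interp _))

  ⟦app⟧ : ∀ {σ τ} (s : Tm (σ ⇒ τ)) (t : Tm σ) → ⟦ app s t ⟧ ≡ ap F ⟦ s ⟧ ⟦ t ⟧
  ⟦app⟧ s t = ⟦⟧-unique (ev-app (proj₂ (interp s)) (proj₂ (interp t)))

  ⟦norm-app⟧ : ∀ {norm : NormOp} → IsNormalizer norm → ∀ {σ τ} (s : Tm (σ ⇒ τ)) (t : Tm σ)
             → ⟦ norm (app s t) ⟧ ≡ ap F ⟦ s ⟧ ⟦ t ⟧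
  ⟦norm-app⟧ isN s t = trans
    (⟦⟧-unique (Equivalence.from (IsNormalizer.N4 isN F I interp _ _) (proj₂ (interp (app s t)))))
    (⟦app⟧ s t)

  _≟_ : ∀ {σ} (a b : D F σ) → Dec (a ≡ b)
  _≟_ {σ} a b = Dec.map (eq-is-id σ a b) (val (ap F (ap F (I (eqn σ)) a) b) Bool.≟ true)

  ⟪_⟫ : Formula → Bool
  ⟪ s ⟫ = val ⟦ s ⟧

  Holds : Formula → Set
  Holds s = ⟪ s ⟫ ≡ true

  ⟪~⟫ : ∀ s → ⟪ ~ s ⟫ ≡ not ⟪ s ⟫
  ⟪~⟫ s = trans (cong val (⟦⟧-unique (ev-app (ev-nm neg) (proj₂ (interp s))))) (neg-is-not ⟦ s ⟧)

  ~-holds⁺ : ∀ {s} → ⟪ s ⟫ ≡ false → Holds (~ s)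
  ~-holds⁺ {s} s-false = trans (⟪~⟫ s) (cong not s-false)

  ~-holds⁻ : ∀ {s} → Holds (~ s) → ⟪ s ⟫ ≡ false
  ~-holds⁻ {s} ~s = not-injective (trans (sym (⟪~⟫ s)) ~s)

  ~~-holds⁻ : ∀ {s} → Holds (~ (~ s)) → Holds s
  ~~-holds⁻ {s} ~~s = not-injective (trans (sym (⟪~⟫ s)) (~-holds⁻ ~~s))

  ≐-holds : ∀ {σ} (s t : Tm σ) → Holds (s ≐ t) ⇔ (⟦ s ⟧ ≡ ⟦ t ⟧)
  ≐-holds {σ} s t = subst (λ v → (val v ≡ true) ⇔ (⟦ s ⟧ ≡ ⟦ t ⟧))
    (sym (⟦⟧-unique (ev-app (ev-app (ev-nm (eqn σ)) (proj₂ (interp s))) (proj₂ (interp t)))))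
    (eq-is-id σ ⟦ s ⟧ ⟦ t ⟧)

  ≐-holds⁺ : ∀ {σ} {s t : Tm σ} → ⟦ s ⟧ ≡ ⟦ t ⟧ → Holds (s ≐ t)
  ≐-holds⁺ = Equivalence.from (≐-holds _ _)

  ≐-holds⁻ : ∀ {σ} {s t : Tm σ} → Holds (s ≐ t) → ⟦ s ⟧ ≡ ⟦ t ⟧
  ≐-holds⁻ = Equivalence.to (≐-holds _ _)

  ≠-holds⁺ : ∀ {σ} {s t : Tm σ} → ⟦ s ⟧ ≢ ⟦ t ⟧ → Holds (s ≠ t)
  ≠-holds⁺ s≢t = ~-holds⁺ (¬-not λ s≐t → s≢t (≐-holds⁻ s≐t))

  ≠-holds⁻ : ∀ {σ} {s t : Tm σ} → Holds (s ≠ t) → ⟦ s ⟧ ≢ ⟦ t ⟧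
  ≠-holds⁻ s≠t s≡t = not-¬ (≐-holds⁺ s≡t) (~-holds⁻ s≠t)

  ⟪⟫-injective : ∀ {s t} → ⟪ s ⟫ ≡ ⟪ t ⟫ → ⟦ s ⟧ ≡ ⟦ t ⟧
  ⟪⟫-injective = Bijection.injective truth

module _ {A : List Formula} {F : Frame} {I : Asg F} (M : Model A F I) where
  open Model M
  open Logical logical using (val)
  open Denotation logical interp

  Model-holds : ∀ {s} → s ∈ A → Holds s
  Model-holds s∈A with true-in _ s∈A
  ... | v , s↦v , v-true = trans (cong val (⟦⟧-unique s↦v)) v-true

  Model-++ : ∀ {C} → All Holds C → Model (C ++ A) F I
  Model-++ {C} C-holds = record
    { logical = logical
    ; interp  = interp
    ; true-in = λ s s∈ → [ (λ s∈C → ⟦ s ⟧ , proj₂ (interp s) , All.lookup C-holds s∈C)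
                        , true-in s ]′ (∈-++⁻ C s∈)
    }

Model-upd : ∀ {A F I σ n} (a : D F σ) → ¬ FreeInBranch (var σ n) A
          → Model A F I → Model A F (upd F I (var σ n) a)
Model-upd {F = F} {σ = σ} {n} a fresh M = record
  { logical = Logical-upd logical σ n a
  ; interp  = Interpretation-upd interp (var σ n) a
  ; true-in = λ s s∈A → let (v , s↦v , v-true) = true-in s s∈A
                        in v , Eval-upd-fresh fresh (λ _ → lose s∈A) s↦v , v-true
  }
  where
  open Evaluation F
  open Model M

module Soundness (norm : NormOp) (isN : IsNormalizer norm) where
  open Tableau norm

  AllUnsatisfiable : List Formula → List (List Formula) → Set₁
  AllUnsatisfiable A alts = ∀ C → C ∈ alts → ¬ Satisfiable (C ++ A)

  module _ {A : List Formula} {F : Frame} {I : Asg F} (M : Model A F I) where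
    open Evaluation F
    open Model M
    open Logical logical using (val)
    open Denotation logical interp

    alternative-fails : ∀ {C alts} → AllUnsatisfiable A alts → C ∈ alts → ¬ All Holds C
    alternative-fails unsat C∈ C-holds = unsat _ C∈ (F , I , Model-++ M C-holds)

    apps-cong : ∀ {σ ρ} (b : Base ρ) (ss ts : Args σ ρ) {h h′ : Tm σ}
              → AllUnsatisfiable A (diffs b ss ts) → ⟦ h ⟧ ≡ ⟦ h′ ⟧ → ⟦ apps h ss ⟧ ≡ ⟦ apps h′ ts ⟧
    apps-cong b ε ε unsat h≡h′ = h≡h′
    apps-cong () ε (_ ◂ _)
    apps-cong () (_ ◂ _) ε
    apps-cong b (s ◂ ss) (t ◂ ts) {h} {h′} unsat h≡h′ with ⟦ s ⟧ ≟ ⟦ t ⟧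
    ... | no s≢t = ⊥-elim (alternative-fails unsat (here refl) (≠-holds⁺ s≢t ∷ []))
    ... | yes s≡t = apps-cong b ss ts (λ C C∈ → unsat C (there C∈)) (begin
      ⟦ app h s ⟧        ≡⟨ ⟦app⟧ h s ⟩
      ap F ⟦ h ⟧ ⟦ s ⟧   ≡⟨ cong₂ (ap F) h≡h′ s≡t ⟩
      ap F ⟦ h′ ⟧ ⟦ t ⟧  ≡⟨ ⟦app⟧ h′ t ⟨
      ⟦ app h′ t ⟧       ∎)
      where open ≡-Reasoning

    FE-sound : ∀ {σ τ} {s t : Tm (σ ⇒ τ)} n → (s ≠ t) ∈ A → ¬ FreeInBranch (var σ n) A
             → ¬ AllUnsatisfiable A (((norm (app s (nm (var σ n))) ≠ norm (app t (nm (var σ n)))) ∷ []) ∷ [])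
    FE-sound {σ} {s = s} {t} n s≠t∈A fresh unsat =
      ≠-holds⁻ (Model-holds M s≠t∈A) (ext F _ _ pointwise)
      where
      x = var σ n

      pointwise : ∀ a → ap F ⟦ s ⟧ a ≡ ap F ⟦ t ⟧ a
      pointwise a with ap F ⟦ s ⟧ a ≟ ap F ⟦ t ⟧ a
      ... | yes sa≡ta = sa≡ta
      ... | no sa≢ta  = ⊥-elim (unsat _ (here refl) (F , upd F I x a , Model-++ Mₐ (Iₐ.≠-holds⁺ differ ∷ [])))
        where
        Mₐ = Model-upd a fresh M
        module Iₐ = Denotation (Model.logical Mₐ) (Model.interp Mₐ)

        instance-value : ∀ {r} → (∀ z → FreeIn z r → FreeIn z (s ≠ t))
                       → Iₐ.⟦ norm (app r (nm x)) ⟧ ≡ ap F ⟦ r ⟧ a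
        instance-value {r} r⊆ = begin
          Iₐ.⟦ norm (app r (nm x)) ⟧  ≡⟨ Iₐ.⟦norm-app⟧ isN r (nm x) ⟩
          ap F Iₐ.⟦ r ⟧ Iₐ.⟦ nm x ⟧   ≡⟨ cong₂ (ap F) (Iₐ.⟦⟧-unique r↦) (Iₐ.⟦⟧-unique (ev-nm x)) ⟩
          ap F ⟦ r ⟧ (upd F I x a x)  ≡⟨ cong (ap F ⟦ r ⟧) (upd-same I x a) ⟩
          ap F ⟦ r ⟧ a                ∎
          where
          open ≡-Reasoning
          r↦ = Eval-upd-fresh fresh (λ z → lose s≠t∈A ∘ r⊆ z) (proj₂ (interp r))

        differ : Iₐ.⟦ norm (app s (nm x)) ⟧ ≢ Iₐ.⟦ norm (app t (nm x)) ⟧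
        differ sₐ≡tₐ = sa≢ta (begin
          ap F ⟦ s ⟧ a                ≡⟨ instance-value (λ _ → free-app₂ ∘ free-app₁ ∘ free-app₂) ⟨
          Iₐ.⟦ norm (app s (nm x)) ⟧  ≡⟨ sₐ≡tₐ ⟩
          Iₐ.⟦ norm (app t (nm x)) ⟧  ≡⟨ instance-value (λ _ → free-app₂ ∘ free-app₂) ⟩
          ap F ⟦ t ⟧ a                ∎)
          where open ≡-Reasoning

    BQ-sound : ∀ {s t : Formula} → ⟪ s ⟫ ≡ ⟪ t ⟫
             → ¬ AllUnsatisfiable A ((s ∷ t ∷ []) ∷ ((~ s) ∷ (~ t) ∷ []) ∷ [])
    BQ-sound {s} s≡t unsat with ⟪ s ⟫ in s-val
    ... | true  = alternative-fails unsat (here refl) (s-val ∷ sym s≡t ∷ [])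
    ... | false = alternative-fails unsat (there (here refl)) (~-holds⁺ s-val ∷ ~-holds⁺ (sym s≡t) ∷ [])

    BE-sound : ∀ {s t : Formula} → ⟪ t ⟫ ≡ not ⟪ s ⟫
             → ¬ AllUnsatisfiable A ((s ∷ (~ t) ∷ []) ∷ ((~ s) ∷ t ∷ []) ∷ [])
    BE-sound {s} t≡¬s unsat with ⟪ s ⟫ in s-val
    ... | true  = alternative-fails unsat (here refl) (s-val ∷ ~-holds⁺ t≡¬s ∷ [])
    ... | false = alternative-fails unsat (there (here refl)) (~-holds⁺ s-val ∷ t≡¬s ∷ [])

    Con-sound : ∀ {k} {s t u v : Tm (srt k)} → ⟦ s ⟧ ≡ ⟦ t ⟧ → ⟦ u ⟧ ≢ ⟦ v ⟧
              → ¬ AllUnsatisfiable A (((s ≠ u) ∷ (t ≠ u) ∷ []) ∷ ((s ≠ v) ∷ (t ≠ v) ∷ []) ∷ [])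
    Con-sound {s = s} {u = u} s≡t u≢v unsat with ⟦ s ⟧ ≟ ⟦ u ⟧
    ... | no s≢u  = alternative-fails unsat (here refl)
                      (≠-holds⁺ s≢u ∷ ≠-holds⁺ (λ t≡u → s≢u (trans s≡t t≡u)) ∷ [])
    ... | yes s≡u = alternative-fails unsat (there (here refl))
                      (≠-holds⁺ s≢v ∷ ≠-holds⁺ (λ t≡v → s≢v (trans s≡t t≡v)) ∷ [])
      where
      s≢v : ⟦ s ⟧ ≢ _
      s≢v s≡v = u≢v (trans (sym s≡u) s≡v)

    Step-sound : ∀ {alts} → Step A alts → ¬ AllUnsatisfiable A alts
    Step-sound (DN ~~s∈A) unsat =
      alternative-fails unsat (here refl) (~~-holds⁻ (Model-holds M ~~s∈A) ∷ [])
    Step-sound (BQ s≐t∈A) = BQ-sound (cong val (≐-holds⁻ (Model-holds M s≐t∈A)))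
    Step-sound (BE s≠t∈A) =
      BE-sound (¬-not λ t≡s → ≠-holds⁻ (Model-holds M s≠t∈A) (sym (⟪⟫-injective t≡s)))
    Step-sound (FQ {s = s} {t} s≐t∈A u _) unsat = alternative-fails unsat (here refl) (≐-holds⁺ (begin
      ⟦ norm (app s u) ⟧  ≡⟨ ⟦norm-app⟧ isN s u ⟩
      ap F ⟦ s ⟧ ⟦ u ⟧    ≡⟨ cong (λ f → ap F f ⟦ u ⟧) (≐-holds⁻ (Model-holds M s≐t∈A)) ⟩
      ap F ⟦ t ⟧ ⟦ u ⟧    ≡⟨ ⟦norm-app⟧ isN t u ⟨
      ⟦ norm (app t u) ⟧  ∎) ∷ [])
      where open ≡-Reasoning
    Step-sound (FE s≠t∈A n fresh _) = FE-sound n s≠t∈A fresh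
    Step-sound (MatR n ss ts xss∈A ~xts∈A) unsat =
      not-¬ (trans (cong val (apps-cong _ ss ts unsat refl)) (~-holds⁻ (Model-holds M ~xts∈A)))
            (Model-holds M xss∈A)
    Step-sound (DecR k n ss ts xss≠xts∈A) unsat =
      ≠-holds⁻ (Model-holds M xss≠xts∈A) (apps-cong _ ss ts unsat refl)
    Step-sound (Con s≐t∈A u≠v∈A) =
      Con-sound (≐-holds⁻ (Model-holds M s≐t∈A)) (≠-holds⁻ (Model-holds M u≠v∈A))

  Refutable⇒unsatisfiable : ∀ {A} → Refutable A → ¬ Satisfiable A
  Refutable⇒unsatisfiable (refute r _ refuted) (_ , _ , M) =
    Step-sound M r λ C C∈ → Refutable⇒unsatisfiable (refuted C C∈)

-- Soundness needs neither that the branch is normal nor the admissibility restrictions.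
proposition5p1 : (norm : NormOp) → IsNormalizer norm
    → (A : List Formula) → All (Normal norm) A
    → Tableau.Refutable norm A → ¬ Satisfiable A
proposition5p1 norm isN A _ = Soundness.Refutable⇒unsatisfiable norm isN
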